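{- Let $m$ be an odd positive integer. There exists an optimal quaternary sequence (OQS) of length $m$ if and only if there exists a quasi-orthogonal cocycle $\psi\in Z^2(\mathbb{Z}_2\times\mathbb{Z}_m,\{\pm1\})$ that is not a coboundary.
   Context: A quaternary sequence $f:\mathbb{Z}_m\to\{\pm1,\pm\mathrm{i}\}$ of odd length $m$ is an OQS if $|R_f(w)|=1$ for $1\le w\le m-1$, where $R_f(w)=\sum_{k\in\mathbb{Z}_m}f(k)\overline{f(k+w)}$. For a finite group $G$, $Z^2(G,\{\pm1\})$ is the set of normalized cocycles $\psi:G\times G\to\{\pm1\}$ ($\psi(g,h)\psi(gh,k)=\psi(g,hk)\psi(h,k)$ for all $g,h,k$, and $\psi(1,1)=1$); coboundaries are $\partial\varphi(g,h)=\varphi(g)\varphi(h)\varphi(gh)$ for maps $\varphi:G\to\{\pm1\}$, forming $B^2(G,\{\pm1\})$. $M_\psi=[\psi(g,h)]_{g,h\in G}$ and its row excess is $RE(M_\psi)=\sum_{g\ne1}|\sum_h\psi(g,h)|$. For $|G|=4t+2$, $\psi$ is quasi-orthogonal if either $\psi\notin B^2$ and $RE(M_\psi)=4t$, or $\psi\in B^2$ and $RE(M_\psi)=8t+2$. -}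

module Defs where

open import Data.Nat as ℕ using (ℕ; zero; suc)
open import Data.Nat.DivMod using (_%_; m%n<n)
open import Data.Fin as Fin using (Fin; toℕ; fromℕ<)
open import Data.Integer as ℤ using (ℤ; _◃_; ∣_∣)
open import Data.Sign as Sign using (Sign)
open import Data.List using (List; foldr; map; allFin; filter; cartesianProduct)
open import Data.Product using (Σ; _×_; _,_; proj₁; proj₂)
open import Data.Sum using (_⊎_)
open import Relation.Nullary using (¬_)
open import Relation.Binary.PropositionalEquality using (_≡_; _≢_)

-- Cyclic group ℤ_m, represented on Fin (suc n) (m = suc n ≥ 1)

_+ₘ_ : ∀ {n} → Fin (suc n) → Fin (suc n) → Fin (suc n)
_+ₘ_ {n} a b = fromℕ< (m%n<n (toℕ a ℕ.+ toℕ b) (suc n))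

-- Gaussian integers ℤ[i] as pairs (re , im)

Gauss : Set
Gauss = ℤ × ℤ

_+ᵍ_ : Gauss → Gauss → Gauss
(a , b) +ᵍ (c , d) = (a ℤ.+ c , b ℤ.+ d)

_*ᵍ_ : Gauss → Gauss → Gauss
(a , b) *ᵍ (c , d) = (a ℤ.* c ℤ.- b ℤ.* d , a ℤ.* d ℤ.+ b ℤ.* c)

conjᵍ : Gauss → Gauss
conjᵍ (a , b) = (a , ℤ.- b)

normᵍ : Gauss → ℤ
normᵍ (a , b) = a ℤ.* a ℤ.+ b ℤ.* b

-- a quaternary value is i^k for k ∈ {0,1,2,3}, i.e. 1, i, -1, -i
quat : Fin 4 → Gauss
quat Fin.zero                         = (ℤ.+ 1 , ℤ.+ 0)
quat (Fin.suc Fin.zero)               = (ℤ.+ 0 , ℤ.+ 1)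
quat (Fin.suc (Fin.suc Fin.zero))     = (ℤ.-[1+ 0 ] , ℤ.+ 0)
quat (Fin.suc (Fin.suc (Fin.suc _)))  = (ℤ.+ 0 , ℤ.-[1+ 0 ])

QSeq : ℕ → Set
QSeq n = Fin (suc n) → Fin 4

sumᵍ : List Gauss → Gauss
sumᵍ = foldr _+ᵍ_ (ℤ.+ 0 , ℤ.+ 0)

autocorr : ∀ {n} → QSeq n → Fin (suc n) → Gauss
autocorr {n} f w =
  sumᵍ (map (λ k → quat (f k) *ᵍ conjᵍ (quat (f (k +ₘ w)))) (allFin (suc n)))

IsOQS : ∀ {n} → QSeq n → Set
IsOQS {n} f = ∀ (w : Fin (suc n)) → w ≢ Fin.zero → normᵍ (autocorr f w) ≡ ℤ.+ 1

-- The group G = ℤ_2 × ℤ_m (written multiplicatively in the paper)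

Grp : ℕ → Set
Grp n = Fin 2 × Fin (suc n)

_·_ : ∀ {n} → Grp n → Grp n → Grp n
(a , b) · (c , d) = (a +ₘ c , b +ₘ d)

one : ∀ {n} → Grp n
one = (Fin.zero , Fin.zero)

elems : ∀ n → List (Grp n)
elems n = cartesianProduct (allFin 2) (allFin (suc n))

-- {±1} is represented by Data.Sign (+ ↦ 1, - ↦ -1), with its multiplication

IsCocycle : ∀ {n} → (Grp n → Grp n → Sign) → Set
IsCocycle {n} ψ =
  (∀ (g h k : Grp n) → ψ g h Sign.* ψ (g · h) k ≡ ψ g (h · k) Sign.* ψ h k)
  × ψ one one ≡ Sign.+

IsCoboundary : ∀ {n} → (Grp n → Grp n → Sign) → Set
IsCoboundary {n} ψ =
  Σ (Grp n → Sign) λ φ → ∀ (g h : Grp n) → ψ g h ≡ φ g Sign.* φ h Sign.* φ (g · h)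

toℤ : Sign → ℤ
toℤ s = s ◃ 1

sumℤ : List ℤ → ℤ
sumℤ = foldr ℤ._+_ (ℤ.+ 0)

sumℕ : List ℕ → ℕ
sumℕ = foldr ℕ._+_ 0

rowExcess : ∀ {n} → (Grp n → Grp n → Sign) → ℕ
rowExcess {n} ψ =
  sumℕ (map (λ g → ∣ sumℤ (map (λ h → toℤ (ψ g h)) (elems n)) ∣)
            (filter (λ g → Relation.Nullary.¬? (≟G g one)) (elems n)))
  where
  open import Relation.Nullary using (¬?)
  open import Data.Product.Properties using (≡-dec)
  ≟G = ≡-dec Fin._≟_ Fin._≟_

IsQuasiOrthogonal : ∀ {n} → (Grp n → Grp n → Sign) → Set
IsQuasiOrthogonal {n} ψ =
  Σ ℕ λ t → (4 ℕ.* t ℕ.+ 2 ≡ 2 ℕ.* suc n) ×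
    ((¬ IsCoboundary ψ × rowExcess ψ ≡ 4 ℕ.* t)
     ⊎ (IsCoboundary ψ × rowExcess ψ ≡ 8 ℕ.* t ℕ.+ 2))

module Submission where

-- A quaternary sequence of length m is a pair (a , b) of binary sequences, and twice its
-- autocorrelation at shift w is (A_a + A_b)(w) + (C_ab - C_ba)(w) i, with A the periodic
-- autocorrelation and C the cross-correlation. Every A_s(w) is congruent to m mod 4, so for odd m
-- the real part is odd and the sequence is optimal iff |A_a + A_b| = 2 off the origin and the
-- imaginary part vanishes. On the cocycle side, oddness of m makes every non-coboundary cocycle
-- on Z_2 x Z_m equal to twist * ∂φ, where twist is inflated from the nontrivial class in
-- H²(Z_2, ±1). The rows (0 , w) and (1 , w) of this cocycle sum to ±(A_a + A_b)(w) and
-- ±(C_ab - C_ba)(w), where a = φ(0 , -) and b = φ(1 , -). Hence its row excess is at least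
-- 2(m - 1) = 4t, with equality iff the sequence encoded by (a , b) is optimal.

open import Defs
open import Level using (0ℓ)
open import Algebra.Bundles using (CommutativeMonoid)
open import Algebra.Structures using (IsCommutativeMonoid)
open import Algebra.Properties.CommutativeSemigroup using (interchange)
open import Data.Empty using (⊥-elim)
open import Data.Fin as Fin using (Fin; toℕ; fromℕ<)
open import Data.Fin.Permutation using (Permutation; permutation)
open import Data.Fin.Properties using (toℕ-fromℕ<; toℕ-injective; toℕ<n)
open import Data.Integer as ℤ using (ℤ; +_; -[1+_]; ∣_∣; _+_; _*_; _-_; -_; -1ℤ)
import Data.Integer.Properties as ℤP
open import Data.Integer.Tactic.RingSolver using (solve-∀)
open import Data.List as List using (List; []; _∷_; foldr; map; allFin; tabulate; filter)
open import Data.List.Properties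
  using (map-tabulate; map-++; map-∘; ++-identityʳ; map-cong; filter-++; filter-all; filter-reject)
open import Data.List.Relation.Unary.All as All using (All)
open import Data.List.Relation.Unary.All.Properties using (map⁺; ++⁺)
open import Data.Nat as ℕ using (ℕ; zero; suc; _%_)
open import Data.Nat.DivMod using (_/_; %-distribˡ-+; m%n%n≡m%n; m<n⇒m%n≡m; n%n≡0; m%n<n; m≡m%n+[m/n]*n)
import Data.Nat.Properties as ℕP
import Data.Nat.Tactic.RingSolver as ℕSolver
open import Data.Product using (Σ; _×_; _,_; proj₁; proj₂)
open import Data.Product.Properties using (≡-dec)
open import Data.Sign as Sign using (Sign)
import Data.Sign.Properties as SignP
open import Algebra.Properties.Monoid.Mult SignP.*-monoid using (×-homo-+) renaming (_×_ to _×ˢ_)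
open import Algebra.Properties.Semiring.Sum ℤP.+-*-semiring using (*-distribˡ-sum)
open import Data.Sum using (inj₁; [_,_]′)
open import Function using (_∘_; id)
open import Function.Bundles using (_⇔_; mk⇔; Equivalence)
open import Relation.Binary.PropositionalEquality
open import Relation.Nullary using (¬_; ¬?)
open import Relation.Unary using (Decidable)

pattern 0₂ = Fin.zero
pattern 1₂ = Fin.suc Fin.zero

module _ {n : ℕ} where

  private
    m : ℕ
    m = suc n

  toℕ-+ₘ : ∀ (x y : Fin m) → toℕ (x +ₘ y) ≡ (toℕ x ℕ.+ toℕ y) % m
  toℕ-+ₘ x y = toℕ-fromℕ< _

  private
    %-absorbˡ : ∀ i j → (i % m ℕ.+ j) % m ≡ (i ℕ.+ j) % m
    %-absorbˡ i j = begin
      (i % m ℕ.+ j) % m            ≡⟨ %-distribˡ-+ (i % m) j m ⟩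
      (i % m % m ℕ.+ j % m) % m    ≡⟨ cong (λ k → (k ℕ.+ j % m) % m) (m%n%n≡m%n i m) ⟩
      (i % m ℕ.+ j % m) % m        ≡⟨ %-distribˡ-+ i j m ⟨
      (i ℕ.+ j) % m                ∎
      where open ≡-Reasoning

  +ₘ-comm : ∀ (x y : Fin m) → x +ₘ y ≡ y +ₘ x
  +ₘ-comm x y = toℕ-injective (begin
    toℕ (x +ₘ y)              ≡⟨ toℕ-+ₘ x y ⟩
    (toℕ x ℕ.+ toℕ y) % m     ≡⟨ cong (_% m) (ℕP.+-comm (toℕ x) (toℕ y)) ⟩
    (toℕ y ℕ.+ toℕ x) % m     ≡⟨ toℕ-+ₘ y x ⟨
    toℕ (y +ₘ x)              ∎)
    where open ≡-Reasoning

  +ₘ-assoc : ∀ (x y z : Fin m) → (x +ₘ y) +ₘ z ≡ x +ₘ (y +ₘ z)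
  +ₘ-assoc x y z = toℕ-injective (begin
    toℕ ((x +ₘ y) +ₘ z)                    ≡⟨ toℕ-+ₘ (x +ₘ y) z ⟩
    (toℕ (x +ₘ y) ℕ.+ toℕ z) % m           ≡⟨ cong (λ k → (k ℕ.+ toℕ z) % m) (toℕ-+ₘ x y) ⟩
    ((toℕ x ℕ.+ toℕ y) % m ℕ.+ toℕ z) % m  ≡⟨ %-absorbˡ (toℕ x ℕ.+ toℕ y) (toℕ z) ⟩
    (toℕ x ℕ.+ toℕ y ℕ.+ toℕ z) % m        ≡⟨ cong (_% m) (ℕP.+-assoc (toℕ x) (toℕ y) (toℕ z)) ⟩
    (toℕ x ℕ.+ (toℕ y ℕ.+ toℕ z)) % m      ≡⟨ cong (_% m) (ℕP.+-comm (toℕ x) _) ⟩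
    ((toℕ y ℕ.+ toℕ z) ℕ.+ toℕ x) % m      ≡⟨ %-absorbˡ (toℕ y ℕ.+ toℕ z) (toℕ x) ⟨
    ((toℕ y ℕ.+ toℕ z) % m ℕ.+ toℕ x) % m  ≡⟨ cong (λ k → (k ℕ.+ toℕ x) % m) (toℕ-+ₘ y z) ⟨
    (toℕ (y +ₘ z) ℕ.+ toℕ x) % m           ≡⟨ cong (_% m) (ℕP.+-comm (toℕ (y +ₘ z)) (toℕ x)) ⟩
    (toℕ x ℕ.+ toℕ (y +ₘ z)) % m           ≡⟨ toℕ-+ₘ x (y +ₘ z) ⟨
    toℕ (x +ₘ (y +ₘ z))                    ∎)
    where open ≡-Reasoning

  +ₘ-identityˡ : ∀ (x : Fin m) → Fin.zero +ₘ x ≡ x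
  +ₘ-identityˡ x = toℕ-injective (trans (toℕ-+ₘ Fin.zero x) (m<n⇒m%n≡m (toℕ<n x)))

  +ₘ-identityʳ : ∀ (x : Fin m) → x +ₘ Fin.zero ≡ x
  +ₘ-identityʳ x = trans (+ₘ-comm x Fin.zero) (+ₘ-identityˡ x)

  -ₘ_ : Fin m → Fin m
  -ₘ x = fromℕ< (m%n<n (m ℕ.∸ toℕ x) m)

  +ₘ-inverseʳ : ∀ (x : Fin m) → x +ₘ (-ₘ x) ≡ Fin.zero
  +ₘ-inverseʳ x = toℕ-injective (begin
    toℕ (x +ₘ (-ₘ x))                  ≡⟨ toℕ-+ₘ x (-ₘ x) ⟩
    (toℕ x ℕ.+ toℕ (-ₘ x)) % m         ≡⟨ cong (λ k → (toℕ x ℕ.+ k) % m) (toℕ-fromℕ< _) ⟩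
    (toℕ x ℕ.+ (m ℕ.∸ toℕ x) % m) % m  ≡⟨ cong (_% m) (ℕP.+-comm (toℕ x) _) ⟩
    ((m ℕ.∸ toℕ x) % m ℕ.+ toℕ x) % m  ≡⟨ %-absorbˡ (m ℕ.∸ toℕ x) (toℕ x) ⟩
    (m ℕ.∸ toℕ x ℕ.+ toℕ x) % m        ≡⟨ cong (_% m) (ℕP.m∸n+n≡m (ℕP.<⇒≤ (toℕ<n x))) ⟩
    m % m                              ≡⟨ n%n≡0 m ⟩
    0                                  ∎)
    where open ≡-Reasoning

  +ₘ-inverseˡ : ∀ (x : Fin m) → (-ₘ x) +ₘ x ≡ Fin.zero
  +ₘ-inverseˡ x = trans (+ₘ-comm (-ₘ x) x) (+ₘ-inverseʳ x)

  private
    cancel : ∀ x y → x +ₘ y ≡ Fin.zero → ∀ z → x +ₘ (y +ₘ z) ≡ z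
    cancel x y x+y≡0 z = begin
      x +ₘ (y +ₘ z)    ≡⟨ +ₘ-assoc x y z ⟨
      (x +ₘ y) +ₘ z    ≡⟨ cong (_+ₘ z) x+y≡0 ⟩
      Fin.zero +ₘ z    ≡⟨ +ₘ-identityˡ z ⟩
      z                ∎
      where open ≡-Reasoning

  translation : Fin m → Permutation m m
  translation w = permutation (w +ₘ_) ((-ₘ w) +ₘ_) (cancel w (-ₘ w) (+ₘ-inverseʳ w)) (cancel (-ₘ w) w (+ₘ-inverseˡ w))

module _ {n : ℕ} where

  ι : Fin (suc n) → Grp n
  ι x = (0₂ , x)

  τ : Grp n
  τ = (1₂ , Fin.zero)

  ·-assoc : ∀ (g h k : Grp n) → (g · h) · k ≡ g · (h · k)
  ·-assoc (a , x) (b , y) (c , z) = cong₂ _,_ (+ₘ-assoc a b c) (+ₘ-assoc x y z)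

  ·-comm : ∀ (g h : Grp n) → g · h ≡ h · g
  ·-comm (a , x) (b , y) = cong₂ _,_ (+ₘ-comm a b) (+ₘ-comm x y)

  ·-identityˡ : ∀ (g : Grp n) → one · g ≡ g
  ·-identityˡ (a , x) = cong₂ _,_ (+ₘ-identityˡ a) (+ₘ-identityˡ x)

  ·-ι-decomposition : ∀ a x → (a , x) ≡ (a , Fin.zero) · ι x
  ·-ι-decomposition a x = sym (cong₂ _,_ (+ₘ-identityʳ a) (+ₘ-identityˡ x))

module FiniteSum {A : Set} {_∙_ : A → A → A} {ε : A}
                 (isCommutativeMonoid : IsCommutativeMonoid _≡_ _∙_ ε) where

  open IsCommutativeMonoid isCommutativeMonoid using (assoc; identityˡ)

  commutativeMonoid : CommutativeMonoid 0ℓ 0ℓ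
  commutativeMonoid = record { isCommutativeMonoid = isCommutativeMonoid }

  open import Algebra.Properties.CommutativeMonoid.Sum commutativeMonoid using (sum-permute)
  open import Algebra.Properties.CommutativeMonoid.Sum commutativeMonoid public
    using (sum; sum-cong-≗; ∑-distrib-+; sum-replicate)
  open ≡-Reasoning

  foldr-++ : ∀ xs ys → foldr _∙_ ε (xs List.++ ys) ≡ foldr _∙_ ε xs ∙ foldr _∙_ ε ys
  foldr-++ []       ys = sym (identityˡ _)
  foldr-++ (x ∷ xs) ys = begin
    x ∙ foldr _∙_ ε (xs List.++ ys)            ≡⟨ cong (x ∙_) (foldr-++ xs ys) ⟩
    x ∙ (foldr _∙_ ε xs ∙ foldr _∙_ ε ys)      ≡⟨ assoc x _ _ ⟨
    (x ∙ foldr _∙_ ε xs) ∙ foldr _∙_ ε ys      ∎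

  foldr-map-allFin : ∀ {k} (F : Fin k → A) → foldr _∙_ ε (map F (allFin k)) ≡ sum F
  foldr-map-allFin F = trans (cong (foldr _∙_ ε) (map-tabulate id F)) (foldr-tabulate F)
    where
    foldr-tabulate : ∀ {k} (F : Fin k → A) → foldr _∙_ ε (tabulate F) ≡ sum F
    foldr-tabulate {zero}  F = refl
    foldr-tabulate {suc k} F = cong (F Fin.zero ∙_) (foldr-tabulate (F ∘ Fin.suc))

  foldr-map-elems : ∀ {n} (F : Grp n → A) →
    foldr _∙_ ε (map F (elems n)) ≡ sum (F ∘ (0₂ ,_)) ∙ sum (F ∘ (1₂ ,_))
  foldr-map-elems {n} F = begin
    foldr _∙_ ε (map F (row₀ List.++ row₁ List.++ []))
      ≡⟨ cong (foldr _∙_ ε) (map-++ F row₀ _) ⟩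
    foldr _∙_ ε (map F row₀ List.++ map F (row₁ List.++ []))
      ≡⟨ foldr-++ (map F row₀) _ ⟩
    foldr _∙_ ε (map F row₀) ∙ foldr _∙_ ε (map F (row₁ List.++ []))
      ≡⟨ cong₂ _∙_ (sum-row 0₂) (trans (cong (foldr _∙_ ε ∘ map F) (++-identityʳ row₁)) (sum-row 1₂)) ⟩
    sum (F ∘ (0₂ ,_)) ∙ sum (F ∘ (1₂ ,_))
      ∎
    where
    row₀ row₁ : List (Grp n)
    row₀ = map (0₂ ,_) (allFin (suc n))
    row₁ = map (1₂ ,_) (allFin (suc n))
    sum-row : ∀ a → foldr _∙_ ε (map F (map (a ,_) (allFin (suc n)))) ≡ sum (F ∘ (a ,_))
    sum-row a = trans (cong (foldr _∙_ ε) (sym (map-∘ (allFin (suc n))))) (foldr-map-allFin (F ∘ (a ,_)))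

  sum-translate : ∀ {n} (F : Fin (suc n) → A) w → sum (λ x → F (w +ₘ x)) ≡ sum F
  sum-translate F w = sym (sum-permute F (translation w))

module ℤΣ = FiniteSum ℤP.+-0-isCommutativeMonoid
module ℕΣ = FiniteSum ℕP.+-0-isCommutativeMonoid
module Π = FiniteSum SignP.*-isCommutativeMonoid

ℤΣ-const : ∀ {k} c → ℤΣ.sum {k} (λ _ → c) ≡ + k * c
ℤΣ-const {zero}  c = sym (ℤP.*-zeroˡ c)
ℤΣ-const {suc k} c = begin
  c + ℤΣ.sum {k} (λ _ → c)   ≡⟨ cong (λ z → c + z) (ℤΣ-const {k} c) ⟩
  c + + k * c                ≡⟨ cong (ℤ._+ + k * c) (ℤP.*-identityˡ c) ⟨
  + 1 * c + + k * c          ≡⟨ ℤP.*-distribʳ-+ c (+ 1) (+ k) ⟨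
  (+ 1 + + k) * c            ≡⟨ cong (ℤ._* c) (ℤP.pos-+ 1 k) ⟨
  + suc k * c                ∎
  where open ≡-Reasoning

ℤΣ-neg : ∀ {k} (F : Fin k → ℤ) → ℤΣ.sum (λ x → - F x) ≡ - ℤΣ.sum F
ℤΣ-neg F = begin
  ℤΣ.sum (λ x → - F x)       ≡⟨ ℤΣ.sum-cong-≗ (λ x → ℤP.-1*i≡-i (F x)) ⟨
  ℤΣ.sum (λ x → -1ℤ * F x)   ≡⟨ *-distribˡ-sum -1ℤ F ⟨
  -1ℤ * ℤΣ.sum F             ≡⟨ ℤP.-1*i≡-i (ℤΣ.sum F) ⟩
  - ℤΣ.sum F                 ∎
  where open ≡-Reasoning

toℤ-* : ∀ s t → toℤ (s Sign.* t) ≡ toℤ s * toℤ t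
toℤ-* s t = ℤP.◃-distrib-* s t 1 1

*-square-cancel : ∀ c s t → (c Sign.* s) Sign.* (c Sign.* t) ≡ s Sign.* t
*-square-cancel c s t =
  trans (interchange SignP.*-commutativeSemigroup c s c t) (cong (Sign._* (s Sign.* t)) (SignP.s*s≡+ c))

BinSeq : ℕ → Set
BinSeq n = Fin (suc n) → Sign

module _ {n : ℕ} where

  corr : BinSeq n → BinSeq n → Fin (suc n) → ℤ
  corr a b w = ℤΣ.sum (λ x → toℤ (a x Sign.* b (x +ₘ w)))

  reCorr imCorr : BinSeq n → BinSeq n → Fin (suc n) → ℤ
  reCorr a b w = corr a a w + corr b b w
  imCorr a b w = corr a b w - corr b a w

  corr-scale : ∀ c a b w → corr (λ x → c Sign.* a x) (λ x → c Sign.* b x) w ≡ corr a b w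
  corr-scale c a b w = ℤΣ.sum-cong-≗ (λ x → cong toℤ (*-square-cancel c (a x) (b (x +ₘ w))))

  reCorr-scale : ∀ c a b w → reCorr (λ x → c Sign.* a x) (λ x → c Sign.* b x) w ≡ reCorr a b w
  reCorr-scale c a b w = cong₂ _+_ (corr-scale c a a w) (corr-scale c b b w)

  imCorr-scale : ∀ c a b w → imCorr (λ x → c Sign.* a x) (λ x → c Sign.* b x) w ≡ imCorr a b w
  imCorr-scale c a b w = cong₂ _-_ (corr-scale c a b w) (corr-scale c b a w)

  imCorr-zero : ∀ a b → imCorr a b Fin.zero ≡ + 0
  imCorr-zero a b = trans (cong (_- corr b a Fin.zero) corr-swap) (ℤP.+-inverseʳ (corr b a Fin.zero))
    where
    corr-swap : corr a b Fin.zero ≡ corr b a Fin.zero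
    corr-swap = ℤΣ.sum-cong-≗ λ x → cong toℤ (begin
      a x Sign.* b (x +ₘ Fin.zero)   ≡⟨ cong (λ y → a x Sign.* b y) (+ₘ-identityʳ x) ⟩
      a x Sign.* b x                 ≡⟨ SignP.*-comm (a x) (b x) ⟩
      b x Sign.* a x                 ≡⟨ cong (λ y → b x Sign.* a y) (+ₘ-identityʳ x) ⟨
      b x Sign.* a (x +ₘ Fin.zero)   ∎)
      where open ≡-Reasoning

  private
    isMinus : Sign → ℤ
    isMinus Sign.+ = + 0
    isMinus Sign.- = + 1

    toℤ-via-isMinus : ∀ s t →
      toℤ (s Sign.* t) ≡ + 1 + (-[1+ 1 ] * (isMinus s + isMinus t) + + 4 * (isMinus s * isMinus t))
    toℤ-via-isMinus Sign.+ Sign.+ = refl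
    toℤ-via-isMinus Sign.+ Sign.- = refl
    toℤ-via-isMinus Sign.- Sign.+ = refl
    toℤ-via-isMinus Sign.- Sign.- = refl

  -- Summing toℤ-via-isMinus, translation invariance turns the linear terms into -4 Σ isMinus ∘ s.
  corr-self-mod4 : ∀ s w → Σ ℤ λ k → corr s s w ≡ + suc n + + 4 * k
  corr-self-mod4 s w = (V - U) , (begin
    corr s s w
      ≡⟨ ℤΣ.sum-cong-≗ (λ x → toℤ-via-isMinus (s x) (s (x +ₘ w))) ⟩
    ℤΣ.sum (λ x → + 1 + (-[1+ 1 ] * P x + + 4 * Q x))
      ≡⟨ ℤΣ.∑-distrib-+ {suc n} (λ _ → + 1) (λ x → -[1+ 1 ] * P x + + 4 * Q x) ⟩
    ℤΣ.sum {suc n} (λ _ → + 1) + ℤΣ.sum (λ x → -[1+ 1 ] * P x + + 4 * Q x)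
      ≡⟨ cong₂ _+_ (ℤΣ-const {suc n} (+ 1)) (ℤΣ.∑-distrib-+ (λ x → -[1+ 1 ] * P x) (λ x → + 4 * Q x)) ⟩
    + suc n * + 1 + (ℤΣ.sum (λ x → -[1+ 1 ] * P x) + ℤΣ.sum (λ x → + 4 * Q x))
      ≡⟨ cong₂ (λ p q → + suc n * + 1 + (p + q)) (*-distribˡ-sum -[1+ 1 ] P) (*-distribˡ-sum (+ 4) Q) ⟨
    + suc n * + 1 + (-[1+ 1 ] * ℤΣ.sum P + + 4 * V)
      ≡⟨ cong (λ p → + suc n * + 1 + (-[1+ 1 ] * p + + 4 * V)) ΣP≡U+U ⟩
    + suc n * + 1 + (-[1+ 1 ] * (U + U) + + 4 * V)
      ≡⟨ rearrange (+ suc n) U V ⟩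
    + suc n + + 4 * (V - U)
      ∎)
    where
    open ≡-Reasoning
    P Q : Fin (suc n) → ℤ
    P x = isMinus (s x) + isMinus (s (x +ₘ w))
    Q x = isMinus (s x) * isMinus (s (x +ₘ w))
    U V : ℤ
    U = ℤΣ.sum (isMinus ∘ s)
    V = ℤΣ.sum Q
    ΣP≡U+U : ℤΣ.sum P ≡ U + U
    ΣP≡U+U = begin
      ℤΣ.sum P
        ≡⟨ ℤΣ.∑-distrib-+ (isMinus ∘ s) (λ x → isMinus (s (x +ₘ w))) ⟩
      U + ℤΣ.sum (λ x → isMinus (s (x +ₘ w)))
        ≡⟨ cong (λ z → U + z) (ℤΣ.sum-cong-≗ (λ x → cong (isMinus ∘ s) (+ₘ-comm x w))) ⟩
      U + ℤΣ.sum (λ x → isMinus (s (w +ₘ x)))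
        ≡⟨ cong (λ z → U + z) (ℤΣ.sum-translate (isMinus ∘ s) w) ⟩
      U + U
        ∎
    rearrange : ∀ m U V → m * + 1 + (-[1+ 1 ] * (U + U) + + 4 * V) ≡ m + + 4 * (V - U)
    rearrange = solve-∀

-- The pair of signs (s , t) encodes the quaternary value ((s + t) + (s - t) i) / 2.
pairToQuat : Sign → Sign → Fin 4
pairToQuat Sign.+ Sign.+ = Fin.zero
pairToQuat Sign.+ Sign.- = Fin.suc Fin.zero
pairToQuat Sign.- Sign.- = Fin.suc (Fin.suc Fin.zero)
pairToQuat Sign.- Sign.+ = Fin.suc (Fin.suc (Fin.suc Fin.zero))

quatFst quatSnd : Fin 4 → Sign
quatFst Fin.zero                                = Sign.+
quatFst (Fin.suc Fin.zero)                      = Sign.+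
quatFst (Fin.suc (Fin.suc Fin.zero))            = Sign.-
quatFst (Fin.suc (Fin.suc (Fin.suc Fin.zero)))  = Sign.-
quatSnd Fin.zero                                = Sign.+
quatSnd (Fin.suc Fin.zero)                      = Sign.-
quatSnd (Fin.suc (Fin.suc Fin.zero))            = Sign.-
quatSnd (Fin.suc (Fin.suc (Fin.suc Fin.zero)))  = Sign.+

pairToQuat-quatFst-quatSnd : ∀ p → pairToQuat (quatFst p) (quatSnd p) ≡ p
pairToQuat-quatFst-quatSnd Fin.zero                                = refl
pairToQuat-quatFst-quatSnd (Fin.suc Fin.zero)                      = refl
pairToQuat-quatFst-quatSnd (Fin.suc (Fin.suc Fin.zero))            = refl
pairToQuat-quatFst-quatSnd (Fin.suc (Fin.suc (Fin.suc Fin.zero)))  = refl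

twiceᵍ : Gauss → Gauss
twiceᵍ (x , y) = (+ 2 * x , + 2 * y)

twice-quat-product : ∀ s t s′ t′ →
  twiceᵍ (quat (pairToQuat s t) *ᵍ conjᵍ (quat (pairToQuat s′ t′)))
    ≡ (toℤ (s Sign.* s′) + toℤ (t Sign.* t′) , toℤ (s Sign.* t′) - toℤ (t Sign.* s′))
twice-quat-product Sign.+ Sign.+ Sign.+ Sign.+ = refl
twice-quat-product Sign.+ Sign.+ Sign.+ Sign.- = refl
twice-quat-product Sign.+ Sign.+ Sign.- Sign.+ = refl
twice-quat-product Sign.+ Sign.+ Sign.- Sign.- = refl
twice-quat-product Sign.+ Sign.- Sign.+ Sign.+ = refl
twice-quat-product Sign.+ Sign.- Sign.+ Sign.- = refl
twice-quat-product Sign.+ Sign.- Sign.- Sign.+ = refl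
twice-quat-product Sign.+ Sign.- Sign.- Sign.- = refl
twice-quat-product Sign.- Sign.+ Sign.+ Sign.+ = refl
twice-quat-product Sign.- Sign.+ Sign.+ Sign.- = refl
twice-quat-product Sign.- Sign.+ Sign.- Sign.+ = refl
twice-quat-product Sign.- Sign.+ Sign.- Sign.- = refl
twice-quat-product Sign.- Sign.- Sign.+ Sign.+ = refl
twice-quat-product Sign.- Sign.- Sign.+ Sign.- = refl
twice-quat-product Sign.- Sign.- Sign.- Sign.+ = refl
twice-quat-product Sign.- Sign.- Sign.- Sign.- = refl

sumᵍ-map : ∀ {A : Set} (G : A → Gauss) xs → sumᵍ (map G xs) ≡ (sumℤ (map (proj₁ ∘ G) xs) , sumℤ (map (proj₂ ∘ G) xs))
sumᵍ-map G []       = refl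
sumᵍ-map G (x ∷ xs) = cong (G x +ᵍ_) (sumᵍ-map G xs)

module _ {n : ℕ} where

  pairSeq : BinSeq n → BinSeq n → QSeq n
  pairSeq a b x = pairToQuat (a x) (b x)

  autocorr-cong : ∀ {f g : QSeq n} → (∀ x → f x ≡ g x) → ∀ w → autocorr f w ≡ autocorr g w
  autocorr-cong f≗g w =
    cong sumᵍ (map-cong (λ k → cong₂ (λ p q → quat p *ᵍ conjᵍ (quat q)) (f≗g k) (f≗g (k +ₘ w))) (allFin (suc n)))

  twice-autocorr-pairSeq : ∀ a b w → twiceᵍ (autocorr (pairSeq a b) w) ≡ (reCorr a b w , imCorr a b w)
  twice-autocorr-pairSeq a b w = begin
    twiceᵍ (autocorr (pairSeq a b) w)
      ≡⟨ cong twiceᵍ (sumᵍ-map G (allFin (suc n))) ⟩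
    (+ 2 * sumℤ (map (proj₁ ∘ G) L) , + 2 * sumℤ (map (proj₂ ∘ G) L))
      ≡⟨ cong₂ (λ p q → (+ 2 * p , + 2 * q)) (ℤΣ.foldr-map-allFin (proj₁ ∘ G)) (ℤΣ.foldr-map-allFin (proj₂ ∘ G)) ⟩
    (+ 2 * ℤΣ.sum (proj₁ ∘ G) , + 2 * ℤΣ.sum (proj₂ ∘ G))
      ≡⟨ cong₂ _,_ (*-distribˡ-sum (+ 2) (proj₁ ∘ G)) (*-distribˡ-sum (+ 2) (proj₂ ∘ G)) ⟩
    (ℤΣ.sum (λ x → + 2 * proj₁ (G x)) , ℤΣ.sum (λ x → + 2 * proj₂ (G x)))
      ≡⟨ cong₂ _,_ (ℤΣ.sum-cong-≗ (cong proj₁ ∘ twice-G)) (ℤΣ.sum-cong-≗ (cong proj₂ ∘ twice-G)) ⟩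
    (ℤΣ.sum (λ x → corrTerm a a x + corrTerm b b x) , ℤΣ.sum (λ x → corrTerm a b x - corrTerm b a x))
      ≡⟨ cong₂ _,_ (ℤΣ.∑-distrib-+ (corrTerm a a) (corrTerm b b)) ΣIm ⟩
    (reCorr a b w , imCorr a b w)                                      ∎
    where
    open ≡-Reasoning
    L : List (Fin (suc n))
    L = allFin (suc n)
    G : Fin (suc n) → Gauss
    G k = quat (pairSeq a b k) *ᵍ conjᵍ (quat (pairSeq a b (k +ₘ w)))
    corrTerm : BinSeq n → BinSeq n → Fin (suc n) → ℤ
    corrTerm p q x = toℤ (p x Sign.* q (x +ₘ w))
    twice-G : ∀ x → twiceᵍ (G x) ≡ (corrTerm a a x + corrTerm b b x , corrTerm a b x - corrTerm b a x)
    twice-G x = twice-quat-product (a x) (b x) (a (x +ₘ w)) (b (x +ₘ w))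
    ΣIm : ℤΣ.sum (λ x → corrTerm a b x - corrTerm b a x) ≡ imCorr a b w
    ΣIm = trans (ℤΣ.∑-distrib-+ (corrTerm a b) (λ x → - corrTerm b a x)) (cong (λ z → corr a b w + z) (ℤΣ-neg (corrTerm b a)))

  IsOptimalPair : BinSeq n → BinSeq n → Set
  IsOptimalPair a b = (∀ j → ∣ reCorr a b (Fin.suc j) ∣ ≡ 2) × (∀ x → imCorr a b x ≡ + 0)

  isOptimalPair-scale : ∀ c a b → IsOptimalPair a b → IsOptimalPair (λ x → c Sign.* a x) (λ x → c Sign.* b x)
  isOptimalPair-scale c a b (∣reCorr∣≡2 , imCorr≡0) =
    (λ j → trans (cong ∣_∣ (reCorr-scale c a b (Fin.suc j))) (∣reCorr∣≡2 j)) ,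
    (λ x → trans (imCorr-scale c a b x) (imCorr≡0 x))

private
  square-abs : ∀ i → i * i ≡ + (∣ i ∣ ℕ.* ∣ i ∣)
  square-abs (+ zero)   = refl
  square-abs (+ suc _)  = refl
  square-abs -[1+ _ ]   = refl

  squares≡1 : ∀ p q → p ≢ 0 → p ℕ.* p ℕ.+ q ℕ.* q ≡ 1 → p ≡ 1 × q ≡ 0
  squares≡1 zero          q       p≢0 _  = ⊥-elim (p≢0 refl)
  squares≡1 (suc zero)    zero    _   _  = refl , refl
  squares≡1 (suc zero)    (suc q) _   ()
  squares≡1 (suc (suc p)) q       _   ()

normᵍ≡1⇔ : ∀ (z : Gauss) → proj₁ z ≢ + 0 → normᵍ z ≡ + 1 ⇔ (∣ proj₁ z ∣ ≡ 1 × proj₂ z ≡ + 0)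
normᵍ≡1⇔ (x , y) x≢0 = mk⇔ to from
  where
  normᵍ≡abs : normᵍ (x , y) ≡ + (∣ x ∣ ℕ.* ∣ x ∣ ℕ.+ ∣ y ∣ ℕ.* ∣ y ∣)
  normᵍ≡abs = cong₂ _+_ (square-abs x) (square-abs y)
  to : normᵍ (x , y) ≡ + 1 → ∣ x ∣ ≡ 1 × y ≡ + 0
  to norm≡1 with squares≡1 ∣ x ∣ ∣ y ∣ (x≢0 ∘ ℤP.∣i∣≡0⇒i≡0) (ℤP.+-injective (trans (sym normᵍ≡abs) norm≡1))
  ... | ∣x∣≡1 , ∣y∣≡0 = ∣x∣≡1 , ℤP.∣i∣≡0⇒i≡0 ∣y∣≡0
  from : ∣ x ∣ ≡ 1 × y ≡ + 0 → normᵍ (x , y) ≡ + 1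
  from (∣x∣≡1 , refl) = trans normᵍ≡abs (cong (λ p → + (p ℕ.* p ℕ.+ 0)) ∣x∣≡1)

twistWith : Sign → Fin 2 → Fin 2 → Sign
twistWith c 1₂ 1₂ = c
twistWith c 0₂ _  = Sign.+
twistWith c 1₂ 0₂ = Sign.+

twistWith-+ : ∀ a b → twistWith Sign.+ a b ≡ Sign.+
twistWith-+ 1₂ 1₂ = refl
twistWith-+ 0₂ _  = refl
twistWith-+ 1₂ 0₂ = refl

twist : Fin 2 → Fin 2 → Sign
twist = twistWith Sign.-

module _ {n : ℕ} where

  ∂ : (Grp n → Sign) → Grp n → Grp n → Sign
  ∂ φ g h = φ g Sign.* φ h Sign.* φ (g · h)

  CocycleIdentity : (Grp n → Grp n → Sign) → Set
  CocycleIdentity ψ = ∀ g h k → ψ g h Sign.* ψ (g · h) k ≡ ψ g (h · k) Sign.* ψ h k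

  *-cocycleIdentity : ∀ {ψ χ} → CocycleIdentity ψ → CocycleIdentity χ →
                      CocycleIdentity (λ g h → ψ g h Sign.* χ g h)
  *-cocycleIdentity {ψ} {χ} ψ-cocycle χ-cocycle g h k = begin
    (ψ g h Sign.* χ g h) Sign.* (ψ (g · h) k Sign.* χ (g · h) k)  ≡⟨ swap (ψ g h) (χ g h) (ψ (g · h) k) (χ (g · h) k) ⟩
    (ψ g h Sign.* ψ (g · h) k) Sign.* (χ g h Sign.* χ (g · h) k)  ≡⟨ cong₂ Sign._*_ (ψ-cocycle g h k) (χ-cocycle g h k) ⟩
    (ψ g (h · k) Sign.* ψ h k) Sign.* (χ g (h · k) Sign.* χ h k)  ≡⟨ swap (ψ g (h · k)) (ψ h k) (χ g (h · k)) (χ h k) ⟩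
    (ψ g (h · k) Sign.* χ g (h · k)) Sign.* (ψ h k Sign.* χ h k)  ∎
    where
    open ≡-Reasoning
    swap : ∀ p q r s → (p Sign.* q) Sign.* (r Sign.* s) ≡ (p Sign.* r) Sign.* (q Sign.* s)
    swap = interchange SignP.*-commutativeSemigroup

  ∂-cocycleIdentity : ∀ φ → CocycleIdentity (∂ φ)
  ∂-cocycleIdentity φ g h k =
    trans (cong (λ ghk → ∂ φ g h Sign.* (φ (g · h) Sign.* φ k Sign.* φ ghk)) (·-assoc g h k))
          (∂-shape (φ g) (φ h) (φ k) (φ (g · h)) (φ (h · k)) (φ (g · (h · k))))
    where
    open import Algebra.Solver.CommutativeMonoid SignP.*-commutativeMonoid using (solve; _⊕_; _⊜_)
    -- both sides are a b c abc up to the squares of ab and bc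
    ∂-shape : ∀ a b c ab bc abc →
      (a Sign.* b Sign.* ab) Sign.* (ab Sign.* c Sign.* abc) ≡ (a Sign.* bc Sign.* abc) Sign.* (b Sign.* c Sign.* bc)
    ∂-shape a b c ab bc abc = begin
      L                      ≡⟨ SignP.*-identityʳ L ⟨
      L Sign.* Sign.+        ≡⟨ cong (L Sign.*_) (SignP.s*s≡+ bc) ⟨
      L Sign.* (bc Sign.* bc)
        ≡⟨ solve 6 (λ a b c ab bc abc → ((((a ⊕ b) ⊕ ab) ⊕ ((ab ⊕ c) ⊕ abc)) ⊕ (bc ⊕ bc))
                                       ⊜ ((((a ⊕ bc) ⊕ abc) ⊕ ((b ⊕ c) ⊕ bc)) ⊕ (ab ⊕ ab))) refl a b c ab bc abc ⟩
      R Sign.* (ab Sign.* ab)  ≡⟨ cong (R Sign.*_) (SignP.s*s≡+ ab) ⟩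
      R Sign.* Sign.+          ≡⟨ SignP.*-identityʳ R ⟩
      R                        ∎
      where
      open ≡-Reasoning
      L R : Sign
      L = (a Sign.* b Sign.* ab) Sign.* (ab Sign.* c Sign.* abc)
      R = (a Sign.* bc Sign.* abc) Sign.* (b Sign.* c Sign.* bc)

  ∂-diagonal : ∀ φ g → g · g ≡ one → ∂ φ g g ≡ φ one
  ∂-diagonal φ g g²≡1 = trans (cong₂ Sign._*_ (SignP.s*s≡+ (φ g)) (cong φ g²≡1)) (SignP.*-identityˡ (φ one))

  twist-cocycleIdentity : CocycleIdentity (λ g h → twist (proj₁ g) (proj₁ h))
  twist-cocycleIdentity (a , _) (b , _) (c , _) = twist-Z₂ a b c
    where
    twist-Z₂ : ∀ a b c → twist a b Sign.* twist (a +ₘ b) c ≡ twist a (b +ₘ c) Sign.* twist b c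
    twist-Z₂ 0₂ 0₂ 0₂ = refl
    twist-Z₂ 0₂ 0₂ 1₂ = refl
    twist-Z₂ 0₂ 1₂ 0₂ = refl
    twist-Z₂ 0₂ 1₂ 1₂ = refl
    twist-Z₂ 1₂ 0₂ 0₂ = refl
    twist-Z₂ 1₂ 0₂ 1₂ = refl
    twist-Z₂ 1₂ 1₂ 0₂ = refl
    twist-Z₂ 1₂ 1₂ 1₂ = refl

  twisted : (Grp n → Sign) → Grp n → Grp n → Sign
  twisted φ g h = twist (proj₁ g) (proj₁ h) Sign.* ∂ φ g h

  twisted-isCocycle : ∀ φ → φ one ≡ Sign.+ → IsCocycle (twisted φ)
  twisted-isCocycle φ φ-one =
    *-cocycleIdentity {ψ = λ g h → twist (proj₁ g) (proj₁ h)} {χ = ∂ φ} twist-cocycleIdentity (∂-cocycleIdentity φ) , normalised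
    where
    normalised : twisted φ one one ≡ Sign.+
    normalised = trans (∂-diagonal φ one refl) φ-one

  twisted-nonCoboundary : ∀ φ → ¬ IsCoboundary (twisted φ)
  twisted-nonCoboundary φ (χ , twisted≡∂χ) = SignP.s≢opposite[s] (φ one) (begin
    φ one                       ≡⟨ ∂-diagonal φ one refl ⟨
    twisted φ one one           ≡⟨ twisted≡∂χ one one ⟩
    ∂ χ one one                 ≡⟨ ∂-diagonal χ one refl ⟩
    χ one                       ≡⟨ ∂-diagonal χ τ refl ⟨
    ∂ χ τ τ                     ≡⟨ twisted≡∂χ τ τ ⟨
    twisted φ τ τ               ≡⟨ cong Sign.opposite (∂-diagonal φ τ refl) ⟩
    Sign.opposite (φ one)       ∎)
    where open ≡-Reasoning

module _ {n : ℕ} where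

  rowSum : (Grp n → Grp n → Sign) → Grp n → ℤ
  rowSum ψ g = sumℤ (map (λ h → toℤ (ψ g h)) (elems n))

  private
    toℤ-*-assoc : ∀ c s t → toℤ (c Sign.* s Sign.* t) ≡ toℤ c * toℤ (s Sign.* t)
    toℤ-*-assoc c s t = trans (cong toℤ (SignP.*-assoc c s t)) (toℤ-* c (s Sign.* t))

    toℤ-opposite : ∀ s → toℤ (Sign.opposite s) ≡ - toℤ s
    toℤ-opposite Sign.+ = refl
    toℤ-opposite Sign.- = refl

  module _ (φ : Grp n → Sign) where

    private
      a b : BinSeq n
      a x = φ (0₂ , x)
      b x = φ (1₂ , x)

      term : ∀ c (s u : BinSeq n) w x → toℤ (c Sign.* s x Sign.* u (w +ₘ x)) ≡ toℤ c * toℤ (s x Sign.* u (x +ₘ w))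
      term c s u w x = trans (toℤ-*-assoc c (s x) (u (w +ₘ x))) (cong (λ y → toℤ c * toℤ (s x Sign.* u y)) (+ₘ-comm w x))

      corrTerm : BinSeq n → BinSeq n → Fin (suc n) → Fin (suc n) → ℤ
      corrTerm s u w x = toℤ (s x Sign.* u (x +ₘ w))

    rowSum-twisted-0 : ∀ w → rowSum (twisted φ) (0₂ , w) ≡ toℤ (a w) * reCorr a b w
    rowSum-twisted-0 w = begin
      rowSum (twisted φ) (0₂ , w)
        ≡⟨ ℤΣ.foldr-map-elems (λ h → toℤ (twisted φ (0₂ , w) h)) ⟩
      ℤΣ.sum (λ x → toℤ (a w Sign.* a x Sign.* a (w +ₘ x))) + ℤΣ.sum (λ x → toℤ (a w Sign.* b x Sign.* b (w +ₘ x)))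
        ≡⟨ cong₂ _+_ (ℤΣ.sum-cong-≗ (term (a w) a a w)) (ℤΣ.sum-cong-≗ (term (a w) b b w)) ⟩
      ℤΣ.sum (λ x → toℤ (a w) * corrTerm a a w x) + ℤΣ.sum (λ x → toℤ (a w) * corrTerm b b w x)
        ≡⟨ cong₂ _+_ (*-distribˡ-sum (toℤ (a w)) (corrTerm a a w)) (*-distribˡ-sum (toℤ (a w)) (corrTerm b b w)) ⟨
      toℤ (a w) * corr a a w + toℤ (a w) * corr b b w
        ≡⟨ ℤP.*-distribˡ-+ (toℤ (a w)) (corr a a w) (corr b b w) ⟨
      toℤ (a w) * reCorr a b w ∎
      where open ≡-Reasoning

    rowSum-twisted-1 : ∀ w → rowSum (twisted φ) (1₂ , w) ≡ toℤ (b w) * imCorr a b w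
    rowSum-twisted-1 w = begin
      rowSum (twisted φ) (1₂ , w)
        ≡⟨ ℤΣ.foldr-map-elems (λ h → toℤ (twisted φ (1₂ , w) h)) ⟩
      ℤΣ.sum (λ x → toℤ (b w Sign.* a x Sign.* b (w +ₘ x))) + ℤΣ.sum (λ x → toℤ (Sign.opposite (b w Sign.* b x Sign.* a (w +ₘ x))))
        ≡⟨ cong₂ _+_ (ℤΣ.sum-cong-≗ (term (b w) a b w)) (ℤΣ.sum-cong-≗ (λ x → toℤ-opposite (b w Sign.* b x Sign.* a (w +ₘ x)))) ⟩
      ℤΣ.sum (λ x → toℤ (b w) * corrTerm a b w x) + ℤΣ.sum (λ x → - toℤ (b w Sign.* b x Sign.* a (w +ₘ x)))
        ≡⟨ cong (λ q → ℤΣ.sum (λ x → toℤ (b w) * corrTerm a b w x) + q)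
                (trans (ℤΣ-neg (λ x → toℤ (b w Sign.* b x Sign.* a (w +ₘ x)))) (cong -_ (ℤΣ.sum-cong-≗ (term (b w) b a w)))) ⟩
      ℤΣ.sum (λ x → toℤ (b w) * corrTerm a b w x) + - ℤΣ.sum (λ x → toℤ (b w) * corrTerm b a w x)
        ≡⟨ cong₂ (λ p q → p + - q) (*-distribˡ-sum (toℤ (b w)) (corrTerm a b w)) (*-distribˡ-sum (toℤ (b w)) (corrTerm b a w)) ⟨
      toℤ (b w) * corr a b w + - (toℤ (b w) * corr b a w)
        ≡⟨ factor (toℤ (b w)) (corr a b w) (corr b a w) ⟩
      toℤ (b w) * imCorr a b w ∎
      where
      open ≡-Reasoning
      factor : ∀ c p q → c * p + - (c * q) ≡ c * (p - q)
      factor = solve-∀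

  nonIdentity-elems : ∀ (P? : Decidable (λ (g : Grp n) → g ≢ one)) →
    filter P? (elems n) ≡ map (λ j → (0₂ , Fin.suc j)) (allFin n) List.++ (map (1₂ ,_) (allFin (suc n)) List.++ [])
  nonIdentity-elems P? = begin
    filter P? (map (0₂ ,_) (allFin (suc n)) List.++ (map (1₂ ,_) (allFin (suc n)) List.++ []))
      ≡⟨ filter-++ P? (map (0₂ ,_) (allFin (suc n))) _ ⟩
    filter P? (map (0₂ ,_) (allFin (suc n))) List.++ filter P? (map (1₂ ,_) (allFin (suc n)) List.++ [])
      ≡⟨ cong₂ List._++_ coset₀ (filter-all P? (++⁺ (nonIdentity (λ _ ()) (allFin (suc n))) All.[])) ⟩
    map (λ j → (0₂ , Fin.suc j)) (allFin n) List.++ (map (1₂ ,_) (allFin (suc n)) List.++ []) ∎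
    where
    open ≡-Reasoning
    nonIdentity : ∀ {A : Set} {f : A → Grp n} → (∀ x → f x ≢ one) → ∀ xs → All (_≢ one) (map f xs)
    nonIdentity f≢one xs = map⁺ (All.universal f≢one xs)
    coset₀ : filter P? (map (0₂ ,_) (allFin (suc n))) ≡ map (λ j → (0₂ , Fin.suc j)) (allFin n)
    coset₀ = begin
      filter P? ((0₂ , Fin.zero) ∷ map (0₂ ,_) (tabulate Fin.suc))   ≡⟨ filter-reject P? (λ ≢one → ≢one refl) ⟩
      filter P? (map (0₂ ,_) (tabulate Fin.suc))                     ≡⟨ cong (filter P?) (map-tabulate Fin.suc (0₂ ,_)) ⟩
      filter P? (tabulate (λ j → (0₂ , Fin.suc j)))                  ≡⟨ cong (filter P?) (map-tabulate id (λ j → (0₂ , Fin.suc j))) ⟨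
      filter P? (map (λ j → (0₂ , Fin.suc j)) (allFin n))            ≡⟨ filter-all P? (nonIdentity (λ _ ()) (allFin n)) ⟩
      map (λ j → (0₂ , Fin.suc j)) (allFin n)                        ∎

  rowExcess-split : ∀ ψ → rowExcess ψ ≡ ℕΣ.sum (λ j → ∣ rowSum ψ (0₂ , Fin.suc j) ∣) ℕ.+ ℕΣ.sum (λ x → ∣ rowSum ψ (1₂ , x) ∣)
  rowExcess-split ψ = begin
    rowExcess ψ
      ≡⟨ cong (sumℕ ∘ map R) (nonIdentity-elems (λ g → ¬? (≡-dec Fin._≟_ Fin._≟_ g one))) ⟩
    sumℕ (map R (row₀ List.++ (row₁ List.++ [])))
      ≡⟨ cong sumℕ (map-++ R row₀ (row₁ List.++ [])) ⟩
    sumℕ (map R row₀ List.++ map R (row₁ List.++ []))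
      ≡⟨ ℕΣ.foldr-++ (map R row₀) (map R (row₁ List.++ [])) ⟩
    sumℕ (map R row₀) ℕ.+ sumℕ (map R (row₁ List.++ []))
      ≡⟨ cong₂ ℕ._+_ (trans (cong sumℕ (sym (map-∘ (allFin n)))) (ℕΣ.foldr-map-allFin (λ j → R (0₂ , Fin.suc j))))
                     (trans (cong (sumℕ ∘ map R) (++-identityʳ row₁))
                            (trans (cong sumℕ (sym (map-∘ (allFin (suc n))))) (ℕΣ.foldr-map-allFin (λ x → R (1₂ , x))))) ⟩
    ℕΣ.sum (λ j → ∣ rowSum ψ (0₂ , Fin.suc j) ∣) ℕ.+ ℕΣ.sum (λ x → ∣ rowSum ψ (1₂ , x) ∣) ∎
    where
    open ≡-Reasoning
    R : Grp n → ℕ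
    R g = ∣ rowSum ψ g ∣
    row₀ row₁ : List (Grp n)
    row₀ = map (λ j → (0₂ , Fin.suc j)) (allFin n)
    row₁ = map (1₂ ,_) (allFin (suc n))

  rowExcess-cong : ∀ {ψ χ} → (∀ g h → ψ g h ≡ χ g h) → rowExcess ψ ≡ rowExcess χ
  rowExcess-cong ψ≗χ = cong sumℕ (map-cong (λ g → cong ∣_∣ (cong sumℤ (map-cong (λ h → cong toℤ (ψ≗χ g h)) (elems n))))
    (filter (λ g → ¬? (≡-dec Fin._≟_ Fin._≟_ g one)) (elems n)))

  rowExcess-twisted : ∀ φ → rowExcess (twisted φ) ≡
    ℕΣ.sum (λ j → ∣ reCorr (φ ∘ (0₂ ,_)) (φ ∘ (1₂ ,_)) (Fin.suc j) ∣) ℕ.+ ℕΣ.sum (λ x → ∣ imCorr (φ ∘ (0₂ ,_)) (φ ∘ (1₂ ,_)) x ∣)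
  rowExcess-twisted φ = trans (rowExcess-split (twisted φ)) (cong₂ ℕ._+_
    (ℕΣ.sum-cong-≗ (λ j → trans (cong ∣_∣ (rowSum-twisted-0 φ (Fin.suc j))) (∣toℤ*∣ (φ (0₂ , Fin.suc j)) _)))
    (ℕΣ.sum-cong-≗ (λ x → trans (cong ∣_∣ (rowSum-twisted-1 φ x)) (∣toℤ*∣ (φ (1₂ , x)) _))))
    where
    ∣toℤ*∣ : ∀ s i → ∣ toℤ s * i ∣ ≡ ∣ i ∣
    ∣toℤ*∣ s i = trans (ℤP.abs-* (toℤ s) i) (trans (cong (ℕ._* ∣ i ∣) (ℤP.abs-◃ s 1)) (ℕP.*-identityˡ ∣ i ∣))

ℕΣ≡0⇔ : ∀ {k} (V : Fin k → ℕ) → ℕΣ.sum V ≡ 0 ⇔ (∀ x → V x ≡ 0)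
ℕΣ≡0⇔ {zero}  V = mk⇔ (λ _ ()) (λ _ → refl)
ℕΣ≡0⇔ {suc k} V = mk⇔
  (λ ΣV≡0 → λ { Fin.zero    → ℕP.m+n≡0⇒m≡0 (V Fin.zero) ΣV≡0
              ; (Fin.suc x) → Equivalence.to (ℕΣ≡0⇔ (V ∘ Fin.suc)) (ℕP.m+n≡0⇒n≡0 (V Fin.zero) ΣV≡0) x })
  (λ V≡0 → cong₂ ℕ._+_ (V≡0 Fin.zero) (Equivalence.from (ℕΣ≡0⇔ (V ∘ Fin.suc)) (V≡0 ∘ Fin.suc)))

ℕΣ-excess : ∀ {k} (U : Fin k → ℕ) → (∀ j → 2 ℕ.≤ U j) → ℕΣ.sum U ≡ 2 ℕ.* k ℕ.+ ℕΣ.sum (λ j → U j ℕ.∸ 2)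
ℕΣ-excess {zero}  U 2≤U = refl
ℕΣ-excess {suc k} U 2≤U = begin
  U Fin.zero ℕ.+ ℕΣ.sum (U ∘ Fin.suc)
    ≡⟨ cong₂ ℕ._+_ (ℕP.m+[n∸m]≡n (2≤U Fin.zero)) (sym (ℕΣ-excess (U ∘ Fin.suc) (2≤U ∘ Fin.suc))) ⟨
  (2 ℕ.+ d Fin.zero) ℕ.+ (2 ℕ.* k ℕ.+ ℕΣ.sum (d ∘ Fin.suc))
    ≡⟨ regroup k (d Fin.zero) (ℕΣ.sum (d ∘ Fin.suc)) ⟩
  2 ℕ.* suc k ℕ.+ (d Fin.zero ℕ.+ ℕΣ.sum (d ∘ Fin.suc))
    ∎
  where
  open ≡-Reasoning
  d : Fin (suc k) → ℕ
  d j = U j ℕ.∸ 2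
  regroup : ∀ k d₀ D → (2 ℕ.+ d₀) ℕ.+ (2 ℕ.* k ℕ.+ D) ≡ 2 ℕ.* suc k ℕ.+ (d₀ ℕ.+ D)
  regroup = ℕSolver.solve-∀

ℕΣ+ℕΣ≡2k⇔ : ∀ {k l} (U : Fin k → ℕ) (V : Fin l → ℕ) → (∀ j → 2 ℕ.≤ U j) →
  ℕΣ.sum U ℕ.+ ℕΣ.sum V ≡ 2 ℕ.* k ⇔ ((∀ j → U j ≡ 2) × (∀ x → V x ≡ 0))
ℕΣ+ℕΣ≡2k⇔ {k} U V 2≤U = mk⇔ to from
  where
  d : Fin k → ℕ
  d j = U j ℕ.∸ 2
  total : ℕΣ.sum U ℕ.+ ℕΣ.sum V ≡ 2 ℕ.* k ℕ.+ (ℕΣ.sum d ℕ.+ ℕΣ.sum V)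
  total = trans (cong (ℕ._+ ℕΣ.sum V) (ℕΣ-excess U 2≤U)) (ℕP.+-assoc (2 ℕ.* k) _ _)
  to : ℕΣ.sum U ℕ.+ ℕΣ.sum V ≡ 2 ℕ.* k → (∀ j → U j ≡ 2) × (∀ x → V x ≡ 0)
  to eq = U≡2 , Equivalence.to (ℕΣ≡0⇔ V) (ℕP.m+n≡0⇒n≡0 (ℕΣ.sum d) excess≡0)
    where
    excess≡0 : ℕΣ.sum d ℕ.+ ℕΣ.sum V ≡ 0
    excess≡0 = ℕP.+-cancelˡ-≡ (2 ℕ.* k) _ 0 (trans (sym total) (trans eq (sym (ℕP.+-identityʳ (2 ℕ.* k)))))
    U≡2 : ∀ j → U j ≡ 2
    U≡2 j = ℕP.≤-antisym (ℕP.m∸n≡0⇒m≤n (Equivalence.to (ℕΣ≡0⇔ d) (ℕP.m+n≡0⇒m≡0 (ℕΣ.sum d) excess≡0) j)) (2≤U j)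
  from : (∀ j → U j ≡ 2) × (∀ x → V x ≡ 0) → ℕΣ.sum U ℕ.+ ℕΣ.sum V ≡ 2 ℕ.* k
  from (U≡2 , V≡0) = begin
    ℕΣ.sum U ℕ.+ ℕΣ.sum V                      ≡⟨ total ⟩
    2 ℕ.* k ℕ.+ (ℕΣ.sum d ℕ.+ ℕΣ.sum V)        ≡⟨ cong₂ (λ p q → 2 ℕ.* k ℕ.+ (p ℕ.+ q)) Σd≡0 (Equivalence.from (ℕΣ≡0⇔ V) V≡0) ⟩
    2 ℕ.* k ℕ.+ 0                              ≡⟨ ℕP.+-identityʳ (2 ℕ.* k) ⟩
    2 ℕ.* k                                    ∎
    where
    open ≡-Reasoning
    Σd≡0 : ℕΣ.sum d ≡ 0
    Σd≡0 = Equivalence.from (ℕΣ≡0⇔ d) (λ j → cong (ℕ._∸ 2) (U≡2 j))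

4t+2≡2[1+n]⇔ : ∀ t n → 4 ℕ.* t ℕ.+ 2 ≡ 2 ℕ.* suc n ⇔ 4 ℕ.* t ≡ 2 ℕ.* n
4t+2≡2[1+n]⇔ t n = mk⇔ (λ eq → ℕP.+-cancelʳ-≡ 2 (4 ℕ.* t) (2 ℕ.* n) (trans eq (2[1+n] n)))
                       (λ eq → trans (cong (ℕ._+ 2) eq) (sym (2[1+n] n)))
  where
  2[1+n] : ∀ n → 2 ℕ.* suc n ≡ 2 ℕ.* n ℕ.+ 2
  2[1+n] = ℕSolver.solve-∀

odd≢0 : ∀ k → + 1 + + 2 * k ≢ + 0
odd≢0 (+ zero)      ()
odd≢0 (+ suc _)     ()
odd≢0 -[1+ zero ]   ()
odd≢0 -[1+ suc _ ]  ()

module OddLength {n t : ℕ} (n≡t+t : n ≡ t ℕ.+ t) where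

  reCorr-twiceOdd : ∀ (a b : BinSeq n) w → Σ ℤ λ k → reCorr a b w ≡ + 2 * (+ 1 + + 2 * k)
  reCorr-twiceOdd a b w = (+ t + k₁ + k₂) , (begin
    corr a a w + corr b b w                                          ≡⟨ cong₂ _+_ corr-a corr-b ⟩
    (+ suc n + + 4 * k₁) + (+ suc n + + 4 * k₂)                      ≡⟨ cong (λ m → (m + + 4 * k₁) + (m + + 4 * k₂)) m≡1+t+t ⟩
    (+ 1 + (+ t + + t) + + 4 * k₁) + (+ 1 + (+ t + + t) + + 4 * k₂)  ≡⟨ regroup (+ t) k₁ k₂ ⟩
    + 2 * (+ 1 + + 2 * (+ t + k₁ + k₂))                              ∎)
    where
    open ≡-Reasoning
    k₁ k₂ : ℤ
    k₁ = proj₁ (corr-self-mod4 a w)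
    k₂ = proj₁ (corr-self-mod4 b w)
    corr-a : corr a a w ≡ + suc n + + 4 * k₁
    corr-a = proj₂ (corr-self-mod4 a w)
    corr-b : corr b b w ≡ + suc n + + 4 * k₂
    corr-b = proj₂ (corr-self-mod4 b w)
    m≡1+t+t : + suc n ≡ + 1 + (+ t + + t)
    m≡1+t+t = trans (cong (λ k → + suc k) n≡t+t) (trans (ℤP.pos-+ 1 (t ℕ.+ t)) (cong (λ z → + 1 + z) (ℤP.pos-+ t t)))
    regroup : ∀ t k₁ k₂ → (+ 1 + (t + t) + + 4 * k₁) + (+ 1 + (t + t) + + 4 * k₂) ≡ + 2 * (+ 1 + + 2 * (t + k₁ + k₂))
    regroup = solve-∀

  private
    halfReCorr : BinSeq n → BinSeq n → Fin (suc n) → ℤ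
    halfReCorr a b w = + 1 + + 2 * proj₁ (reCorr-twiceOdd a b w)

    reCorr≡2*half : ∀ a b w → reCorr a b w ≡ + 2 * halfReCorr a b w
    reCorr≡2*half a b w = proj₂ (reCorr-twiceOdd a b w)

    halfReCorr≢0 : ∀ a b w → halfReCorr a b w ≢ + 0
    halfReCorr≢0 a b w = odd≢0 (proj₁ (reCorr-twiceOdd a b w))

  2≤∣reCorr∣ : ∀ a b w → 2 ℕ.≤ ∣ reCorr a b w ∣
  2≤∣reCorr∣ a b w = begin
    2                                 ≤⟨ ℕP.*-monoʳ-≤ 2 (ℕP.n≢0⇒n>0 (halfReCorr≢0 a b w ∘ ℤP.∣i∣≡0⇒i≡0)) ⟩
    2 ℕ.* ∣ halfReCorr a b w ∣        ≡⟨ ℤP.abs-* (+ 2) (halfReCorr a b w) ⟨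
    ∣ + 2 * halfReCorr a b w ∣        ≡⟨ cong ∣_∣ (reCorr≡2*half a b w) ⟨
    ∣ reCorr a b w ∣                  ∎
    where open ℕP.≤-Reasoning

  autocorr-normᵍ≡1⇔ : ∀ a b w →
    normᵍ (autocorr (pairSeq a b) w) ≡ + 1 ⇔ (∣ reCorr a b w ∣ ≡ 2 × imCorr a b w ≡ + 0)
  autocorr-normᵍ≡1⇔ a b w = mk⇔ to from
    where
    R : Gauss
    R = autocorr (pairSeq a b) w
    x y : ℤ
    x = proj₁ R
    y = proj₂ R
    2x≡reCorr : + 2 * x ≡ reCorr a b w
    2x≡reCorr = cong proj₁ (twice-autocorr-pairSeq a b w)
    2y≡imCorr : + 2 * y ≡ imCorr a b w
    2y≡imCorr = cong proj₂ (twice-autocorr-pairSeq a b w)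
    x≢0 : x ≢ + 0
    x≢0 x≡0 = halfReCorr≢0 a b w (ℤP.*-cancelˡ-≡ (+ 2) (halfReCorr a b w) (+ 0)
      (trans (sym (reCorr≡2*half a b w)) (trans (sym 2x≡reCorr) (cong (+ 2 *_) x≡0))))
    ∣reCorr∣≡2∣x∣ : ∣ reCorr a b w ∣ ≡ 2 ℕ.* ∣ x ∣
    ∣reCorr∣≡2∣x∣ = trans (cong ∣_∣ (sym 2x≡reCorr)) (ℤP.abs-* (+ 2) x)
    to : normᵍ R ≡ + 1 → ∣ reCorr a b w ∣ ≡ 2 × imCorr a b w ≡ + 0
    to norm≡1 = trans ∣reCorr∣≡2∣x∣ (cong (2 ℕ.*_) (proj₁ xy)) , trans (sym 2y≡imCorr) (cong (+ 2 *_) (proj₂ xy))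
      where
      xy : ∣ x ∣ ≡ 1 × y ≡ + 0
      xy = Equivalence.to (normᵍ≡1⇔ R x≢0) norm≡1
    from : ∣ reCorr a b w ∣ ≡ 2 × imCorr a b w ≡ + 0 → normᵍ R ≡ + 1
    from (∣reCorr∣≡2 , imCorr≡0) = Equivalence.from (normᵍ≡1⇔ R x≢0) (∣x∣≡1 , y≡0)
      where
      ∣x∣≡1 : ∣ x ∣ ≡ 1
      ∣x∣≡1 = ℕP.*-cancelˡ-≡ ∣ x ∣ 1 2 (trans (sym ∣reCorr∣≡2∣x∣) ∣reCorr∣≡2)
      y≡0 : y ≡ + 0
      y≡0 = ℤP.*-cancelˡ-≡ (+ 2) y (+ 0) (trans 2y≡imCorr imCorr≡0)

  ∏-const : ∀ c → Π.sum {suc n} (λ _ → c) ≡ c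
  ∏-const c = begin
    Π.sum {suc n} (λ _ → c)     ≡⟨ Π.sum-replicate (suc n) {c} ⟩
    c Sign.* (n ×ˢ c)           ≡⟨ cong (λ k → c Sign.* (k ×ˢ c)) n≡t+t ⟩
    c Sign.* ((t ℕ.+ t) ×ˢ c)   ≡⟨ cong (c Sign.*_) (trans (×-homo-+ c t t) (SignP.s*s≡+ (t ×ˢ c))) ⟩
    c Sign.* Sign.+             ≡⟨ SignP.*-identityʳ c ⟩
    c                           ∎
    where open ≡-Reasoning

  character-trivial : ∀ (χ : Fin (suc n) → Sign) → (∀ x y → χ (x +ₘ y) ≡ χ x Sign.* χ y) →
                      ∀ x → χ x ≡ Sign.+
  character-trivial χ χ-hom x = SignP.*-cancelʳ-≡ (Π.sum χ) (χ x) Sign.+ (begin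
    χ x Sign.* Π.sum χ                         ≡⟨ cong (Sign._* Π.sum χ) (∏-const (χ x)) ⟨
    Π.sum {suc n} (λ _ → χ x) Sign.* Π.sum χ   ≡⟨ Π.∑-distrib-+ {suc n} (λ _ → χ x) χ ⟨
    Π.sum (λ y → χ x Sign.* χ y)               ≡⟨ Π.sum-cong-≗ (λ y → χ-hom x y) ⟨
    Π.sum (λ y → χ (x +ₘ y))                   ≡⟨ Π.sum-translate χ x ⟩
    Π.sum χ                                    ∎)
    where open ≡-Reasoning

  module ι-TrivialCocycle (ψ : Grp n → Grp n → Sign) (ψ-cocycle : CocycleIdentity ψ)
                          (ψ-ι : ∀ g y → ψ g (ι y) ≡ Sign.+) where

    ψ-·ι : ∀ g h y → ψ g (h · ι y) ≡ ψ g h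
    ψ-·ι g h y = sym (SignP.*-cancelʳ-≡ Sign.+ (ψ g h) (ψ g (h · ι y)) (begin
      ψ g h Sign.* Sign.+                ≡⟨ cong (ψ g h Sign.*_) (ψ-ι (g · h) y) ⟨
      ψ g h Sign.* ψ (g · h) (ι y)       ≡⟨ ψ-cocycle g h (ι y) ⟩
      ψ g (h · ι y) Sign.* ψ h (ι y)     ≡⟨ cong (ψ g (h · ι y) Sign.*_) (ψ-ι h y) ⟩
      ψ g (h · ι y) Sign.* Sign.+        ∎))
      where open ≡-Reasoning

    ψ-ι· : ∀ g y h → ψ (g · ι y) h ≡ ψ g h Sign.* ψ (ι y) h
    ψ-ι· g y h = begin
      ψ (g · ι y) h                       ≡⟨ cong (Sign._* ψ (g · ι y) h) (ψ-ι g y) ⟨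
      ψ g (ι y) Sign.* ψ (g · ι y) h      ≡⟨ ψ-cocycle g (ι y) h ⟩
      ψ g (ι y · h) Sign.* ψ (ι y) h      ≡⟨ cong (λ k → ψ g k Sign.* ψ (ι y) h) (·-comm (ι y) h) ⟩
      ψ g (h · ι y) Sign.* ψ (ι y) h      ≡⟨ cong (Sign._* ψ (ι y) h) (ψ-·ι g h y) ⟩
      ψ g h Sign.* ψ (ι y) h              ∎
      where open ≡-Reasoning

    ψ-one : ∀ h → ψ one h ≡ Sign.+
    ψ-one h = trans (sym (SignP.*-cancelʳ-≡ (ψ one h) (ψ one one) (ψ one h)
      (trans (ψ-cocycle one one h) (cong (λ k → ψ one k Sign.* ψ one h) (·-identityˡ h))))) (ψ-ι one Fin.zero)

    ψ-ι-τ : ∀ x → ψ (ι x) τ ≡ Sign.+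
    ψ-ι-τ = character-trivial (λ x → ψ (ι x) τ) (λ x y → ψ-ι· (ι x) y τ)

    ψ≡twistWith : ∀ g h → ψ g h ≡ twistWith (ψ τ τ) (proj₁ g) (proj₁ h)
    ψ≡twistWith (a , x) (b , z) = begin
      ψ (a , x) (b , z)                                   ≡⟨ cong (λ g → ψ g (b , z)) (·-ι-decomposition a x) ⟩
      ψ ((a , Fin.zero) · ι x) (b , z)                    ≡⟨ ψ-ι· (a , Fin.zero) x (b , z) ⟩
      ψ (a , Fin.zero) (b , z) Sign.* ψ (ι x) (b , z)     ≡⟨ cong₂ Sign._*_ (first-factor (a , Fin.zero) b z) (trans (first-factor (ι x) b z) (ψ-ι-Z₂ b)) ⟩
      ψ (a , Fin.zero) (b , Fin.zero) Sign.* Sign.+       ≡⟨ SignP.*-identityʳ (ψ (a , Fin.zero) (b , Fin.zero)) ⟩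
      ψ (a , Fin.zero) (b , Fin.zero)                     ≡⟨ ψ-Z₂ a b ⟩
      twistWith (ψ τ τ) a b                               ∎
      where
      open ≡-Reasoning
      first-factor : ∀ g b z → ψ g (b , z) ≡ ψ g (b , Fin.zero)
      first-factor g b z = trans (cong (ψ g) (·-ι-decomposition b z)) (ψ-·ι g (b , Fin.zero) z)
      ψ-ι-Z₂ : ∀ b → ψ (ι x) (b , Fin.zero) ≡ Sign.+
      ψ-ι-Z₂ 0₂ = ψ-ι (ι x) Fin.zero
      ψ-ι-Z₂ 1₂ = ψ-ι-τ x
      ψ-Z₂ : ∀ a b → ψ (a , Fin.zero) (b , Fin.zero) ≡ twistWith (ψ τ τ) a b
      ψ-Z₂ 0₂ b  = ψ-one (b , Fin.zero)
      ψ-Z₂ 1₂ 0₂ = ψ-ι τ Fin.zero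
      ψ-Z₂ 1₂ 1₂ = refl

  averaging : (Grp n → Grp n → Sign) → Grp n → Sign
  averaging ψ g = Π.sum (λ x → ψ g (ι x))

  -- Multiply the cocycle identity at (g , ι y , ι x) over all x; oddness of m enters as ∏ₓ c = c.
  ψ-ι≡∂averaging : ∀ ψ → CocycleIdentity ψ → ∀ g y → ψ g (ι y) ≡ ∂ (averaging ψ) g (ι y)
  ψ-ι≡∂averaging ψ ψ-cocycle g y = begin
    c                                           ≡⟨ SignP.*-identityʳ c ⟨
    c Sign.* Sign.+                             ≡⟨ cong (c Sign.*_) (SignP.s*s≡+ (φ (g · ι y))) ⟨
    c Sign.* (φ (g · ι y) Sign.* φ (g · ι y))   ≡⟨ SignP.*-assoc c _ _ ⟨
    c Sign.* φ (g · ι y) Sign.* φ (g · ι y)     ≡⟨ cong (Sign._* φ (g · ι y)) key ⟩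
    φ g Sign.* φ (ι y) Sign.* φ (g · ι y)       ∎
    where
    open ≡-Reasoning
    φ : Grp n → Sign
    φ = averaging ψ
    c : Sign
    c = ψ g (ι y)
    key : c Sign.* φ (g · ι y) ≡ φ g Sign.* φ (ι y)
    key = begin
      c Sign.* φ (g · ι y)                                  ≡⟨ cong (Sign._* φ (g · ι y)) (∏-const c) ⟨
      Π.sum {suc n} (λ _ → c) Sign.* φ (g · ι y)            ≡⟨ Π.∑-distrib-+ {suc n} (λ _ → c) (λ x → ψ (g · ι y) (ι x)) ⟨
      Π.sum (λ x → c Sign.* ψ (g · ι y) (ι x))              ≡⟨ Π.sum-cong-≗ (λ x → ψ-cocycle g (ι y) (ι x)) ⟩
      Π.sum (λ x → ψ g (ι (y +ₘ x)) Sign.* ψ (ι y) (ι x))   ≡⟨ Π.∑-distrib-+ (λ x → ψ g (ι (y +ₘ x))) (λ x → ψ (ι y) (ι x)) ⟩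
      Π.sum (λ x → ψ g (ι (y +ₘ x))) Sign.* φ (ι y)         ≡⟨ cong (Sign._* φ (ι y)) (Π.sum-translate (λ x → ψ g (ι x)) y) ⟩
      φ g Sign.* φ (ι y)                                    ∎

  -- ψ ∂φ is + on G × ι Z_m, so it only sees the Z_2 components and is fixed by its value at (τ , τ).
  nonCoboundary⇒twisted : ∀ ψ → CocycleIdentity ψ → ¬ IsCoboundary ψ →
                          Σ (Grp n → Sign) λ φ → ∀ g h → ψ g h ≡ twisted φ g h
  nonCoboundary⇒twisted ψ ψ-cocycle ψ∉B² = φ , by-sign (ψ′ τ τ) refl
    where
    φ : Grp n → Sign
    φ = averaging ψ
    ψ′ : Grp n → Grp n → Sign
    ψ′ g h = ψ g h Sign.* ∂ φ g h
    ψ′-ι : ∀ g y → ψ′ g (ι y) ≡ Sign.+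
    ψ′-ι g y = trans (cong (Sign._* ∂ φ g (ι y)) (ψ-ι≡∂averaging ψ ψ-cocycle g y)) (SignP.s*s≡+ (∂ φ g (ι y)))
    open ι-TrivialCocycle ψ′ (*-cocycleIdentity {ψ = ψ} {χ = ∂ φ} ψ-cocycle (∂-cocycleIdentity φ)) ψ′-ι
    ψ≡ : ∀ g h → ψ g h ≡ twistWith (ψ′ τ τ) (proj₁ g) (proj₁ h) Sign.* ∂ φ g h
    ψ≡ g h = begin
      ψ g h                                   ≡⟨ SignP.*-identityʳ (ψ g h) ⟨
      ψ g h Sign.* Sign.+                     ≡⟨ cong (ψ g h Sign.*_) (SignP.s*s≡+ (∂ φ g h)) ⟨
      ψ g h Sign.* (∂ φ g h Sign.* ∂ φ g h)   ≡⟨ SignP.*-assoc (ψ g h) _ _ ⟨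
      ψ′ g h Sign.* ∂ φ g h                   ≡⟨ cong (Sign._* ∂ φ g h) (ψ≡twistWith g h) ⟩
      twistWith (ψ′ τ τ) (proj₁ g) (proj₁ h) Sign.* ∂ φ g h ∎
      where open ≡-Reasoning
    ψ≡twistWith∂ : ∀ c → ψ′ τ τ ≡ c → ∀ g h → ψ g h ≡ twistWith c (proj₁ g) (proj₁ h) Sign.* ∂ φ g h
    ψ≡twistWith∂ c ψ′ττ≡c g h = trans (ψ≡ g h) (cong (λ c → twistWith c (proj₁ g) (proj₁ h) Sign.* ∂ φ g h) ψ′ττ≡c)
    by-sign : ∀ c → ψ′ τ τ ≡ c → ∀ g h → ψ g h ≡ twisted φ g h
    by-sign Sign.- ψ′ττ≡- = ψ≡twistWith∂ Sign.- ψ′ττ≡-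
    by-sign Sign.+ ψ′ττ≡+ = ⊥-elim (ψ∉B² (φ , λ g h →
      trans (ψ≡twistWith∂ Sign.+ ψ′ττ≡+ g h) (cong (Sign._* ∂ φ g h) (twistWith-+ (proj₁ g) (proj₁ h)))))

  isOQS-pairSeq⇔ : ∀ a b → IsOQS (pairSeq a b) ⇔ IsOptimalPair a b
  isOQS-pairSeq⇔ a b = mk⇔
    (λ oqs → (λ j → proj₁ (optimal-at j (oqs (Fin.suc j) (λ ())))) ,
             (λ { Fin.zero → imCorr-zero a b ; (Fin.suc j) → proj₂ (optimal-at j (oqs (Fin.suc j) (λ ()))) }))
    (λ { (∣reCorr∣≡2 , imCorr≡0) Fin.zero w≢0 → ⊥-elim (w≢0 refl)
       ; (∣reCorr∣≡2 , imCorr≡0) (Fin.suc j) _ →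
           Equivalence.from (autocorr-normᵍ≡1⇔ a b (Fin.suc j)) (∣reCorr∣≡2 j , imCorr≡0 (Fin.suc j)) })
    where
    optimal-at : ∀ j → normᵍ (autocorr (pairSeq a b) (Fin.suc j)) ≡ + 1 →
                 ∣ reCorr a b (Fin.suc j) ∣ ≡ 2 × imCorr a b (Fin.suc j) ≡ + 0
    optimal-at j = Equivalence.to (autocorr-normᵍ≡1⇔ a b (Fin.suc j))

  rowExcess-twisted≡2n⇔ : ∀ φ → rowExcess (twisted φ) ≡ 2 ℕ.* n ⇔ IsOptimalPair (φ ∘ (0₂ ,_)) (φ ∘ (1₂ ,_))
  rowExcess-twisted≡2n⇔ φ = mk⇔
    (λ RE≡2n → let ∣reCorr∣≡2 , ∣imCorr∣≡0 = Equivalence.to tight (trans (sym (rowExcess-twisted φ)) RE≡2n)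
               in ∣reCorr∣≡2 , (ℤP.∣i∣≡0⇒i≡0 ∘ ∣imCorr∣≡0))
    (λ (∣reCorr∣≡2 , imCorr≡0) → trans (rowExcess-twisted φ) (Equivalence.from tight (∣reCorr∣≡2 , cong ∣_∣ ∘ imCorr≡0)))
    where
    a b : BinSeq n
    a = φ ∘ (0₂ ,_)
    b = φ ∘ (1₂ ,_)
    tight : ℕΣ.sum (λ j → ∣ reCorr a b (Fin.suc j) ∣) ℕ.+ ℕΣ.sum (λ x → ∣ imCorr a b x ∣) ≡ 2 ℕ.* n ⇔
            ((∀ j → ∣ reCorr a b (Fin.suc j) ∣ ≡ 2) × (∀ x → ∣ imCorr a b x ∣ ≡ 0))
    tight = ℕΣ+ℕΣ≡2k⇔ (λ j → ∣ reCorr a b (Fin.suc j) ∣) (λ x → ∣ imCorr a b x ∣) (λ j → 2≤∣reCorr∣ a b (Fin.suc j))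

  QuasiOrthogonalNonCoboundary : Set
  QuasiOrthogonalNonCoboundary = Σ (Grp n → Grp n → Sign) λ ψ → IsCocycle ψ × IsQuasiOrthogonal ψ × ¬ IsCoboundary ψ

  2n≡4t : 2 ℕ.* n ≡ 4 ℕ.* t
  2n≡4t = trans (cong (2 ℕ.*_) n≡t+t) (regroup t)
    where
    regroup : ∀ t → 2 ℕ.* (t ℕ.+ t) ≡ 4 ℕ.* t
    regroup = ℕSolver.solve-∀

  oqs⇒quasiOrthogonalNonCoboundary : Σ (QSeq n) IsOQS → QuasiOrthogonalNonCoboundary
  oqs⇒quasiOrthogonalNonCoboundary (f , f-oqs) =
    twisted φ , twisted-isCocycle φ (SignP.s*s≡+ c) ,
    (t , Equivalence.from (4t+2≡2[1+n]⇔ t n) (sym 2n≡4t) , inj₁ (twisted-nonCoboundary φ , rowExcess≡4t)) ,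
    twisted-nonCoboundary φ
    where
    a b : BinSeq n
    a = quatFst ∘ f
    b = quatSnd ∘ f
    -- c makes φ one = c c = +, and multiplying both sequences by c changes no correlation.
    c : Sign
    c = a Fin.zero
    φ : Grp n → Sign
    φ (0₂ , x) = c Sign.* a x
    φ (1₂ , x) = c Sign.* b x
    pairSeq-oqs : IsOQS (pairSeq a b)
    pairSeq-oqs w w≢0 = trans (cong normᵍ (autocorr-cong (λ x → pairToQuat-quatFst-quatSnd (f x)) w)) (f-oqs w w≢0)
    rowExcess≡4t : rowExcess (twisted φ) ≡ 4 ℕ.* t
    rowExcess≡4t = trans (Equivalence.from (rowExcess-twisted≡2n⇔ φ)
                                           (isOptimalPair-scale c a b (Equivalence.to (isOQS-pairSeq⇔ a b) pairSeq-oqs)))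
                         2n≡4t

  quasiOrthogonalNonCoboundary⇒oqs : QuasiOrthogonalNonCoboundary → Σ (QSeq n) IsOQS
  quasiOrthogonalNonCoboundary⇒oqs (ψ , (ψ-cocycle , _) , (t′ , 4t′+2≡2m , quasiOrthogonal) , ψ∉B²) =
    pairSeq a b , Equivalence.from (isOQS-pairSeq⇔ a b) (Equivalence.to (rowExcess-twisted≡2n⇔ φ) rowExcess≡2n)
    where
    φ : Grp n → Sign
    φ = proj₁ (nonCoboundary⇒twisted ψ ψ-cocycle ψ∉B²)
    a b : BinSeq n
    a = φ ∘ (0₂ ,_)
    b = φ ∘ (1₂ ,_)
    rowExcess≡4t′ : rowExcess ψ ≡ 4 ℕ.* t′
    rowExcess≡4t′ = [ proj₂ , (λ (ψ∈B² , _) → ⊥-elim (ψ∉B² ψ∈B²)) ]′ quasiOrthogonal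
    rowExcess≡2n : rowExcess (twisted φ) ≡ 2 ℕ.* n
    rowExcess≡2n = begin
      rowExcess (twisted φ)     ≡⟨ rowExcess-cong (proj₂ (nonCoboundary⇒twisted ψ ψ-cocycle ψ∉B²)) ⟨
      rowExcess ψ               ≡⟨ rowExcess≡4t′ ⟩
      4 ℕ.* t′                  ≡⟨ Equivalence.to (4t+2≡2[1+n]⇔ t′ n) 4t′+2≡2m ⟩
      2 ℕ.* n                   ∎
      where open ≡-Reasoning

odd⇒n≡t+t : ∀ n → suc n % 2 ≡ 1 → n ≡ suc n / 2 ℕ.+ suc n / 2
odd⇒n≡t+t n m-odd = ℕP.suc-injective (begin
  suc n                              ≡⟨ m≡m%n+[m/n]*n (suc n) 2 ⟩
  suc n % 2 ℕ.+ suc n / 2 ℕ.* 2      ≡⟨ cong₂ ℕ._+_ m-odd (double (suc n / 2)) ⟩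
  1 ℕ.+ (suc n / 2 ℕ.+ suc n / 2)    ∎)
  where
  open ≡-Reasoning
  double : ∀ q → q ℕ.* 2 ≡ q ℕ.+ q
  double = ℕSolver.solve-∀

corollary4 : (n : ℕ) → suc n % 2 ≡ 1 →
    (Σ (QSeq n) IsOQS)
    ⇔ (Σ (Grp n → Grp n → Sign) λ ψ →
         IsCocycle ψ × IsQuasiOrthogonal ψ × ¬ IsCoboundary ψ)
corollary4 n m-odd = mk⇔ oqs⇒quasiOrthogonalNonCoboundary quasiOrthogonalNonCoboundary⇒oqs
  where open OddLength {t = suc n / 2} (odd⇒n≡t+t n m-odd)
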